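{- Let $M$ be a loopless matroid and $F\in\mathcal{P}(M)$. Then $\pi^F(\mathcal{K}_M)\subseteq\mathcal{K}_{M^F}$ and $\pi_F(\mathcal{K}_M)\subseteq\mathcal{K}_{M_F}$.
   Context: A matroid $M$ on a finite set $E$ is a collection $\mathcal{L}(M)$ of subsets of $E$ (flats) such that (F1) $E$ is a flat; (F2) intersections of flats are flats; (F3) for every flat $F$, the sets $F_j\setminus F$, for $F_j$ ranging over the minimal flats properly containing $F$, partition $E\setminus F$. $\hat0$ is the intersection of all flats, $\hat1=E$; $M$ is loopless if $\hat0=\emptyset$. $\mathcal{P}(M)=\mathcal{L}(M)\setminus\{\hat0,\hat1\}$. For flats $F\subseteq G$, $M_F^G$ is the matroid on $G\setminus F$ whose flats are $H\setminus F$ for flats $F\subseteq H\subseteq G$; $M^G=M^G_{\hat0}$, $M_F=M_F^E$. For loopless $M$ on ground set $E$: $\mathbb{R}^{\mathcal{P}(M)}$ has basis $\{\delta_F\}$; $\alpha_i=\sum_{F\in\mathcal{P}(M),F\ni i}\delta_F$, $\beta_i=\sum_{F\in\mathcal{P}(M),F\not\ni i}\delta_F$; $W_M=\operatorname{span}\{\alpha_i-\alpha_j\}$, $L_M=\mathbb{R}^{\mathcal{P}(M)}/W_M$, and $\alpha,\beta$ are the images of $\alpha_i,\beta_i$ (independent of $i$). For $F\in\mathcal{P}(M)$ the linear maps $\pi^F:\mathbb{R}^{\mathcal{P}(M)}\to L_{M^F}$, $\delta_G\mapsto\delta_G$ if $G\subsetneq F$, $-\alpha$ if $G=F$, $0$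 otherwise, and $\pi_F:\mathbb{R}^{\mathcal{P}(M)}\to L_{M_F}$, $\delta_G\mapsto\delta_{G\setminus F}$ if $G\supsetneq F$, $-\beta$ if $G=F$, $0$ otherwise, vanish on $W_M$ and hence induce maps $L_M\to L_{M^F}$, $L_M\to L_{M_F}$. A function $c$ on subsets of a set $E'$ is strictly submodular if $c(\emptyset)=c(E')=0$ and $c(I_1)+c(I_2)>c(I_1\cap I_2)+c(I_1\cup I_2)$ for incomparable $\emptyset\subsetneq I_1,I_2\subsetneq E'$. The ample cone $\mathcal{K}_M\subseteq L_M$ is the set of images of $\sum_{F\in\mathcal{P}(M)}c(F)\delta_F$ with $c$ strictly submodular on subsets of the ground set of $M$.
   Formalization: The space $\mathbb{R}^{\mathcal{P}(M)}$, its quotient $L_M$ and the strictly submodular functions $c$ are taken over the rationals instead of the reals. -}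

module Defs where

open import Data.Nat using (ℕ; zero; suc)
open import Data.Bool using (Bool; true; false; _∧_; not; if_then_else_)
open import Data.Bool.Properties using () renaming (_≟_ to _≟ᵇ_)
open import Data.Fin using (Fin)
open import Data.Fin.Subset using (Subset; _∈_; _∉_; _⊆_; _∩_; _∪_; _─_; ⊥)
open import Data.Fin.Subset.Properties using (_⊆?_; _∈?_)
open import Data.List using (List; []; _∷_; map; _++_; foldr; allFin)
open import Data.Bool.ListAction using (any)
open import Data.Vec using (Vec; []; _∷_)
open import Data.Vec.Properties using (≡-dec)
open import Data.Rational using (ℚ; 0ℚ; 1ℚ; _+_; _*_; _-_; -_; _<_)
open import Data.Product using (Σ; _×_; ∃)
open import Relation.Nullary using (¬_)
open import Relation.Nullary.Decidable using (⌊_⌋)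
open import Relation.Binary.PropositionalEquality using (_≡_; _≢_)

_≟ˢ_ : ∀ {n} (S T : Subset n) → Bool
S ≟ˢ T = ⌊ ≡-dec _≟ᵇ_ S T ⌋

_⊆ᵇ_ : ∀ {n} (S T : Subset n) → Bool
S ⊆ᵇ T = ⌊ S ⊆? T ⌋

_⊊ᵇ_ : ∀ {n} (S T : Subset n) → Bool
S ⊊ᵇ T = (S ⊆ᵇ T) ∧ not (S ≟ˢ T)

_∈ᵇ_ : ∀ {n} (i : Fin n) (S : Subset n) → Bool
i ∈ᵇ S = ⌊ i ∈? S ⌋

allSubsets : ∀ n → List (Subset n)
allSubsets zero    = [] ∷ []
allSubsets (suc n) = map (true ∷_) (allSubsets n) ++ map (false ∷_) (allSubsets n)

sumℚ : ∀ {A : Set} → List A → (A → ℚ) → ℚ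
sumℚ xs f = foldr (λ a acc → f a + acc) 0ℚ xs

record FlatSystem (n : ℕ) : Set where
  field
    ground : Subset n
    flat   : Subset n → Bool
open FlatSystem public

module _ {n : ℕ} (M : FlatSystem n) where

  IsFlat : Subset n → Set
  IsFlat S = flat M S ≡ true

  Covers : Subset n → Subset n → Set
  Covers F G = IsFlat G × (F ⊆ G) × (F ≢ G)
             × (∀ H → IsFlat H → F ⊆ H → F ≢ H → H ⊆ G → H ≡ G)

  record IsMatroid : Set where
    field
      flats⊆E : ∀ S → IsFlat S → S ⊆ ground M
      F1      : IsFlat (ground M)
      F2      : ∀ S T → IsFlat S → IsFlat T → IsFlat (S ∩ T)
      -- (F3): for a flat F, the sets G ∖ F (G covering F) partition E ∖ F
      F3      : ∀ F → IsFlat F → ∀ x → x ∈ ground M → x ∉ F →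
                Σ (Subset n) λ G → Covers F G × x ∈ G
                  × (∀ G' → Covers F G' → x ∈ G' → G' ≡ G)

  hat0 : Subset n
  hat0 = foldr (λ S acc → if flat M S then S ∩ acc else acc) (ground M) (allSubsets n)

  Loopless : Set
  Loopless = hat0 ≡ ⊥

  proper : Subset n → Bool
  proper G = flat M G ∧ not (G ≟ˢ hat0) ∧ not (G ≟ˢ ground M)

  minor : Subset n → Subset n → FlatSystem n
  minor F G = record
    { ground = G ─ F
    ; flat   = λ S → any (λ H → flat M H ∧ (F ⊆ᵇ H) ∧ (H ⊆ᵇ G) ∧ (S ≟ˢ (H ─ F)))
                         (allSubsets n)
    }

  upper : Subset n → FlatSystem n
  upper F = minor hat0 F

  lower : Subset n → FlatSystem n
  lower F = minor F (ground M)

-- ℝ^{𝒫(M)} (with rational coefficients): a vector is a function on subsets;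
-- only its values at elements of 𝒫(M) matter.

Vector : ℕ → Set
Vector n = Subset n → ℚ

αv : ∀ {n} → Fin n → Vector n
αv i G = if i ∈ᵇ G then 1ℚ else 0ℚ

βv : ∀ {n} → Fin n → Vector n
βv i G = if i ∈ᵇ G then 0ℚ else 1ℚ

module _ {n : ℕ} (M : FlatSystem n) where

  -- x - y ∈ W_M = span { α_i - α_j : i , j ∈ E }, i.e. x and y have the same
  -- image in L_M
  _≈L_ : Vector n → Vector n → Set
  x ≈L y = Σ (Fin n → Fin n → ℚ) λ μ →
    ∀ G → proper M G ≡ true →
      x G - y G ≡ sumℚ (allFin n) λ i → sumℚ (allFin n) λ j →
        if (i ∈ᵇ ground M) ∧ (j ∈ᵇ ground M)
          then μ i j * (αv i G - αv j G) else 0ℚ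

  StrictlySubmodular : (Subset n → ℚ) → Set
  StrictlySubmodular c =
    (c ⊥ ≡ 0ℚ) × (c (ground M) ≡ 0ℚ) ×
    (∀ I₁ I₂ → I₁ ⊆ ground M → I₂ ⊆ ground M → ¬ (I₁ ⊆ I₂) → ¬ (I₂ ⊆ I₁) →
      c (I₁ ∩ I₂) + c (I₁ ∪ I₂) < c I₁ + c I₂)

  InAmple : Vector n → Set
  InAmple x = Σ (Subset n → ℚ) λ c → StrictlySubmodular c × (x ≈L (λ G → c G))

  -- π^F on representatives, using α_i (i ∈ F) as representative of α in L_{M^F}:
  -- π^F(x) = Σ_{G ∈ 𝒫(M)} x_G π^F(δ_G)
  πUp : Subset n → Fin n → Vector n → Vector n
  πUp F i x H = sumℚ (allSubsets n) λ G →
    if proper M G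
      then x G * (if G ⊊ᵇ F then (if G ≟ˢ H then 1ℚ else 0ℚ)
                  else if G ≟ˢ F then - αv i H else 0ℚ)
      else 0ℚ

  -- π_F on representatives, using β_i (i ∈ E ∖ F) as representative of β in L_{M_F}
  πDown : Subset n → Fin n → Vector n → Vector n
  πDown F i x H = sumℚ (allSubsets n) λ G →
    if proper M G
      then x G * (if F ⊊ᵇ G then (if (G ─ F) ≟ˢ H then 1ℚ else 0ℚ)
                  else if G ≟ˢ F then - βv i H else 0ℚ)
      else 0ℚ

{-# OPTIONS --safe #-}
-- On representatives, both π^F and π_F have the shape  v ↦ (K ↦ v (h K) − v F · r K)  on the proper
-- flats K of the minor, with (h , r) = (id , α_i) for M^F and (_∪ F , β_i) for M_F.  Such a map is
-- linear, and on the flats of the minor  α_a ∘ h − α_a(F) · r  equals  α_(g a) − t  for a map g into the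
-- minor's ground set and a function t independent of a; so it sends the generators α_a − α_b of W_M
-- to generators of W of the minor, hence W_M into it.  Since r is modular and h preserves ∩ and ∪ and
-- reflects ⊆, it also turns a strictly submodular c into a strictly submodular function (its values
-- at ∅ and at the new ground set are 0).  So a witness x ≡ c mod W_M of x ∈ 𝒦_M is mapped to a
-- witness π x ≡ π c of π x lying in the ample cone of the minor.

module Submission where

open import Defs
open import Data.Fin.Subset using (Subset; _∈_; _∉_)
open import Data.Bool using (true)
open import Data.Product using (_×_)
open import Relation.Binary.PropositionalEquality using (_≡_)

open import Algebra.Bundles using (CommutativeMonoid)
import Algebra.Properties.CommutativeSemigroup as CommutativeSemigroupProperties
open import Data.Bool using (false; _∧_; not; if_then_else_)
open import Data.Bool.Properties using (T-≡; not-injective; if-eta) renaming (_≟_ to _≟ᵇ_)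
open import Data.Empty using (⊥-elim)
open import Data.Fin using (Fin)
open import Data.Fin.Properties using () renaming (_≟_ to _≟ᶠ_)
open import Data.Fin.Subset using (_⊆_; _∩_; _∪_; _─_; ⊥)
open import Data.Fin.Subset.Properties
  using ( _∈?_; _⊆?_; ⊆-refl; ⊆-trans; ⊆-antisym; ⊥⊆; ∉⊥; p∩q⊆p; p∩q⊆q; p⊆p∪q; q⊆p∪q; p─q⊆p
        ; x∈p∩q⁺; x∈p∩q⁻; x∈p∪q⁺; x∈p∪q⁻; x∈p∧x∉q⇒x∈p─q; p─⊥≡p
        ; ∪-identityˡ; ∪-idem; ∪-distribʳ-∩; ∪-commutativeMonoid )
open import Data.List using (List; []; _∷_; map; foldr; allFin)
open import Data.List.Properties using (foldr-preservesʳ)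
open import Data.List.Membership.Propositional using (lose) renaming (_∈_ to _∈ˡ_)
open import Data.List.Membership.Propositional.Properties using (∈-map⁺; ∈-map⁻; ∈-++⁺ˡ; ∈-++⁺ʳ; ∈-allFin)
open import Data.List.Relation.Binary.Disjoint.Propositional using (Disjoint)
open import Data.List.Relation.Unary.All as All using ()
open import Data.List.Relation.Unary.AllPairs using ([]; _∷_)
open import Data.List.Relation.Unary.Any using (here; there; satisfied)
open import Data.List.Relation.Unary.Any.Properties using (any⁺; any⁻)
open import Data.List.Relation.Unary.Unique.Propositional using (Unique)
open import Data.List.Relation.Unary.Unique.Propositional.Properties using (allFin⁺; map⁺; ++⁺)
open import Data.Nat using (ℕ; zero; suc)
open import Data.Product using (Σ; _,_; proj₁; proj₂)
open import Data.Rational using (ℚ; 0ℚ; 1ℚ; _+_; _*_; _-_; -_; _<_)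
open import Data.Rational.Properties using (+-comm; +-identityˡ; +-identityʳ; *-identityˡ; *-zeroˡ; *-zeroʳ; +-monoˡ-<)
open import Data.Rational.Solver using (module +-*-Solver)
open import Data.Sum using (inj₁; inj₂; [_,_])
open import Data.Vec using ([]; _∷_) renaming (there to thereᵛ)
open import Data.Vec.Properties using (≡-dec; ∷-injectiveʳ)
open import Function using (_∘_; id; case_of_)
open import Function.Bundles using (Equivalence)
open import Relation.Nullary using (¬_; Dec; yes; no)
open import Relation.Nullary.Decidable using (⌊_⌋; isYes≗does; dec-true; dec-false; toWitness; toWitnessFalse)
open import Relation.Binary.PropositionalEquality
  using (_≢_; refl; sym; trans; cong; cong₂; subst; subst₂; ≢-sym; module ≡-Reasoning)

open +-*-Solver
open ≡-Reasoning

module _ {a} {A : Set a} where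

  ⌊⌋-true : (a? : Dec A) → A → ⌊ a? ⌋ ≡ true
  ⌊⌋-true a? x = trans (isYes≗does a?) (dec-true a? x)

  ⌊⌋-false : (a? : Dec A) → ¬ A → ⌊ a? ⌋ ≡ false
  ⌊⌋-false a? ¬x = trans (isYes≗does a?) (dec-false a? ¬x)

  ⌊⌋-true⁻ : (a? : Dec A) → ⌊ a? ⌋ ≡ true → A
  ⌊⌋-true⁻ a? eq = toWitness {a? = a?} (Equivalence.from T-≡ eq)

  ⌊⌋-false⁻ : (a? : Dec A) → ⌊ a? ⌋ ≡ false → ¬ A
  ⌊⌋-false⁻ a? eq = toWitnessFalse {a? = a?} (Equivalence.from T-≡ (cong not eq))

∧-true⁻ : ∀ {a b} → a ∧ b ≡ true → a ≡ true × b ≡ true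
∧-true⁻ {true} {true} refl = refl , refl

module _ {n : ℕ} {G H : Subset n} where

  ≟ˢ-≡ : G ≡ H → G ≟ˢ H ≡ true
  ≟ˢ-≡ = ⌊⌋-true (≡-dec _≟ᵇ_ G H)

  ≟ˢ-≢ : G ≢ H → G ≟ˢ H ≡ false
  ≟ˢ-≢ = ⌊⌋-false (≡-dec _≟ᵇ_ G H)

  ≟ˢ-≡⁻ : G ≟ˢ H ≡ true → G ≡ H
  ≟ˢ-≡⁻ = ⌊⌋-true⁻ (≡-dec _≟ᵇ_ G H)

  ≟ˢ-≢⁻ : G ≟ˢ H ≡ false → G ≢ H
  ≟ˢ-≢⁻ = ⌊⌋-false⁻ (≡-dec _≟ᵇ_ G H)

  ⊆ᵇ-true : G ⊆ H → G ⊆ᵇ H ≡ true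
  ⊆ᵇ-true = ⌊⌋-true (G ⊆? H)

  ⊆ᵇ-true⁻ : G ⊆ᵇ H ≡ true → G ⊆ H
  ⊆ᵇ-true⁻ = ⌊⌋-true⁻ (G ⊆? H)

  ⊊ᵇ-true : G ⊆ H → G ≢ H → G ⊊ᵇ H ≡ true
  ⊊ᵇ-true G⊆H G≢H rewrite ⊆ᵇ-true G⊆H | ≟ˢ-≢ G≢H = refl

  ⊊ᵇ-true⇒⊆ : G ⊊ᵇ H ≡ true → G ⊆ H
  ⊊ᵇ-true⇒⊆ = ⊆ᵇ-true⁻ ∘ proj₁ ∘ ∧-true⁻

⊊ᵇ-irrefl : ∀ {n} (G : Subset n) → G ⊊ᵇ G ≡ false
⊊ᵇ-irrefl G rewrite ≟ˢ-≡ {G = G} refl with G ⊆ᵇ G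
... | true  = refl
... | false = refl

module _ {n : ℕ} {i : Fin n} {S : Subset n} where

  ∈ᵇ-∈ : i ∈ S → i ∈ᵇ S ≡ true
  ∈ᵇ-∈ = ⌊⌋-true (i ∈? S)

  ∈ᵇ-∉ : i ∉ S → i ∈ᵇ S ≡ false
  ∈ᵇ-∉ = ⌊⌋-false (i ∈? S)

  αv-∈ : i ∈ S → αv i S ≡ 1ℚ
  αv-∈ i∈S rewrite ∈ᵇ-∈ i∈S = refl

  αv-∉ : i ∉ S → αv i S ≡ 0ℚ
  αv-∉ i∉S rewrite ∈ᵇ-∉ i∉S = refl

  βv-∈ : i ∈ S → βv i S ≡ 0ℚ
  βv-∈ i∈S rewrite ∈ᵇ-∈ i∈S = refl

  βv-∉ : i ∉ S → βv i S ≡ 1ℚ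
  βv-∉ i∉S rewrite ∈ᵇ-∉ i∉S = refl

  βv≡1-αv : βv i S ≡ 1ℚ - αv i S
  βv≡1-αv with i ∈ᵇ S
  ... | true  = refl
  ... | false = refl

αv-∪-∉ : ∀ {n} {i : Fin n} (A : Subset n) {B} → i ∉ B → αv i (A ∪ B) ≡ αv i A
αv-∪-∉ {i = i} A {B} i∉B with i ∈? A
... | yes i∈A = αv-∈ (x∈p∪q⁺ (inj₁ i∈A))
... | no  i∉A = αv-∉ ([ i∉A , i∉B ] ∘ x∈p∪q⁻ A B)

Modular : ∀ {n} → (Subset n → ℚ) → Set
Modular r = ∀ A B → r (A ∩ B) + r (A ∪ B) ≡ r A + r B

indicator-modular : ∀ {n} (i : Fin n) (p q : ℚ) → Modular (λ S → if i ∈ᵇ S then p else q)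
indicator-modular i p q A B with i ∈? A | i ∈? B
... | yes i∈A | yes i∈B
  rewrite ∈ᵇ-∈ (x∈p∩q⁺ (i∈A , i∈B)) | ∈ᵇ-∈ (x∈p∪q⁺ {p = A} {B} (inj₁ i∈A)) = refl
... | yes i∈A | no i∉B
  rewrite ∈ᵇ-∉ (i∉B ∘ proj₂ ∘ x∈p∩q⁻ A B) | ∈ᵇ-∈ (x∈p∪q⁺ {p = A} {B} (inj₁ i∈A)) = +-comm q p
... | no i∉A | yes i∈B
  rewrite ∈ᵇ-∉ (i∉A ∘ proj₁ ∘ x∈p∩q⁻ A B) | ∈ᵇ-∈ (x∈p∪q⁺ {p = A} {B} (inj₂ i∈B)) = refl
... | no i∉A | no i∉B
  rewrite ∈ᵇ-∉ (i∉A ∘ proj₁ ∘ x∈p∩q⁻ A B) | ∈ᵇ-∉ ([ i∉A , i∉B ] ∘ x∈p∪q⁻ A B) = refl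

αv-modular : ∀ {n} (i : Fin n) → Modular (αv i)
αv-modular i = indicator-modular i 1ℚ 0ℚ

βv-modular : ∀ {n} (i : Fin n) → Modular (βv i)
βv-modular i = indicator-modular i 0ℚ 1ℚ

x∈p─q⇒x∉q : ∀ {n} (p q : Subset n) {x} → x ∈ p ─ q → x ∉ q
x∈p─q⇒x∉q (_ ∷ p) (_ ∷ q) (thereᵛ x∈p─q) (thereᵛ x∈q) = x∈p─q⇒x∉q p q x∈p─q x∈q

module _ {n : ℕ} where

  p─p≡⊥ : (p : Subset n) → p ─ p ≡ ⊥
  p─p≡⊥ p = ⊆-antisym (λ x∈p─p → ⊥-elim (x∈p─q⇒x∉q p p x∈p─p (p─q⊆p p p x∈p─p))) ⊥⊆

  p─q∪q≡p : ∀ {p q : Subset n} → q ⊆ p → (p ─ q) ∪ q ≡ p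
  p─q∪q≡p {p} {q} q⊆p = ⊆-antisym
    ([ p─q⊆p p q , q⊆p ] ∘ x∈p∪q⁻ (p ─ q) q)
    (λ {x} x∈p → case x ∈? q of λ where
      (yes x∈q) → q⊆p∪q (p ─ q) q x∈q
      (no x∉q)  → p⊆p∪q q (x∈p∧x∉q⇒x∈p─q x∈p x∉q))

  ∪-distribʳ-∪ : ∀ (r p q : Subset n) → (p ∪ q) ∪ r ≡ (p ∪ r) ∪ (q ∪ r)
  ∪-distribʳ-∪ r p q = begin
    (p ∪ q) ∪ r        ≡⟨ cong ((p ∪ q) ∪_) (sym (∪-idem r)) ⟩
    (p ∪ q) ∪ (r ∪ r)  ≡⟨ interchange p q r r ⟩
    (p ∪ r) ∪ (q ∪ r)  ∎
    where open CommutativeSemigroupProperties (CommutativeMonoid.commutativeSemigroup (∪-commutativeMonoid n))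

∈-allSubsets : ∀ {n} (S : Subset n) → S ∈ˡ allSubsets n
∈-allSubsets []                = here refl
∈-allSubsets {suc n} (true ∷ S)  = ∈-++⁺ˡ (∈-map⁺ (true ∷_) (∈-allSubsets S))
∈-allSubsets {suc n} (false ∷ S) = ∈-++⁺ʳ (map (true ∷_) (allSubsets n)) (∈-map⁺ (false ∷_) (∈-allSubsets S))

unique-allSubsets : ∀ n → Unique (allSubsets n)
unique-allSubsets zero    = All.[] ∷ []
unique-allSubsets (suc n) =
  ++⁺ (map⁺ ∷-injectiveʳ (unique-allSubsets n)) (map⁺ ∷-injectiveʳ (unique-allSubsets n)) disjoint
  where
  disjoint : Disjoint (map (true ∷_) (allSubsets n)) (map (false ∷_) (allSubsets n))
  disjoint (∈true , ∈false) with _ , _ , refl ← ∈-map⁻ (true ∷_) ∈true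
                             with _ , _ , () ← ∈-map⁻ (false ∷_) ∈false

module _ {A : Set} where

  sum-cong : ∀ (xs : List A) {f g : A → ℚ} → (∀ a → f a ≡ g a) → sumℚ xs f ≡ sumℚ xs g
  sum-cong []       f≗g = refl
  sum-cong (x ∷ xs) f≗g = cong₂ _+_ (f≗g x) (sum-cong xs f≗g)

  sum-+ : ∀ (xs : List A) (f g : A → ℚ) → sumℚ xs (λ a → f a + g a) ≡ sumℚ xs f + sumℚ xs g
  sum-+ []       f g = refl
  sum-+ (x ∷ xs) f g = trans (cong (f x + g x +_) (sum-+ xs f g))
    (solve 4 (λ a b c d → (a :+ b) :+ (c :+ d) := (a :+ c) :+ (b :+ d)) refl (f x) (g x) (sumℚ xs f) (sumℚ xs g))

  sum-*ˡ : ∀ (xs : List A) (q : ℚ) (f : A → ℚ) → sumℚ xs (λ a → q * f a) ≡ q * sumℚ xs f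
  sum-*ˡ []       q f = sym (*-zeroʳ q)
  sum-*ˡ (x ∷ xs) q f = trans (cong (q * f x +_) (sum-*ˡ xs q f))
    (solve 3 (λ q a b → q :* a :+ q :* b := q :* (a :+ b)) refl q (f x) (sumℚ xs f))

  sum-linear : ∀ (xs : List A) (f g : A → ℚ) (q : ℚ) →
           sumℚ xs f - sumℚ xs g * q ≡ sumℚ xs (λ a → f a - g a * q)
  sum-linear []       f g q = cong (_-_ 0ℚ) (*-zeroˡ q)
  sum-linear (x ∷ xs) f g q = trans
    (solve 5 (λ a b c d q → (a :+ b) :- (c :+ d) :* q := (a :- c :* q) :+ (b :- d :* q)) refl
      (f x) (sumℚ xs f) (g x) (sumℚ xs g) q)
    (cong (f x - g x * q +_) (sum-linear xs f g q))

  sum-vanishing : ∀ (xs : List A) {f : A → ℚ} → (∀ {a} → a ∈ˡ xs → f a ≡ 0ℚ) → sumℚ xs f ≡ 0ℚ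
  sum-vanishing []       f≡0 = refl
  sum-vanishing (x ∷ xs) f≡0 = cong₂ _+_ (f≡0 (here refl)) (sum-vanishing xs (f≡0 ∘ there))

  sum-single : ∀ {xs : List A} {a f} → Unique xs → a ∈ˡ xs →
               (∀ {b} → b ∈ˡ xs → b ≢ a → f b ≡ 0ℚ) → sumℚ xs f ≡ f a
  sum-single {x ∷ xs} {f = f} (x∉xs ∷ _) (here refl) f≡0 = trans
    (cong (f x +_) (sum-vanishing xs (λ b∈xs → f≡0 (there b∈xs) (≢-sym (All.lookup x∉xs b∈xs)))))
    (+-identityʳ (f x))
  sum-single (x∉xs ∷ xs-unique) (there a∈xs) f≡0 = trans
    (cong₂ _+_ (f≡0 (here refl) (All.lookup x∉xs a∈xs)) (sum-single xs-unique a∈xs (f≡0 ∘ there)))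
    (+-identityˡ _)

  sum-pair : ∀ {xs : List A} {a b f} → Unique xs → a ∈ˡ xs → b ∈ˡ xs → a ≢ b →
             (∀ {c} → c ∈ˡ xs → c ≢ a → c ≢ b → f c ≡ 0ℚ) → sumℚ xs f ≡ f a + f b
  sum-pair _ (here refl) (here refl) a≢b _ = ⊥-elim (a≢b refl)
  sum-pair {f = f} (x∉xs ∷ xs-unique) (here refl) (there b∈xs) _ f≡0 =
    cong (f _ +_) (sum-single xs-unique b∈xs λ c∈xs → f≡0 (there c∈xs) (≢-sym (All.lookup x∉xs c∈xs)))
  sum-pair {a = a} {b} {f} (x∉xs ∷ xs-unique) (there a∈xs) (here refl) _ f≡0 = trans
    (cong (f _ +_) (sum-single xs-unique a∈xs λ c∈xs c≢a →
      f≡0 (there c∈xs) c≢a (≢-sym (All.lookup x∉xs c∈xs))))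
    (+-comm (f b) (f a))
  sum-pair (x∉xs ∷ xs-unique) (there a∈xs) (there b∈xs) a≢b f≡0 = trans
    (cong₂ _+_ (f≡0 (here refl) (All.lookup x∉xs a∈xs) (All.lookup x∉xs b∈xs))
               (sum-pair xs-unique a∈xs b∈xs a≢b (f≡0 ∘ there)))
    (+-identityˡ _)

module _ {n : ℕ} (N : FlatSystem n) where

  proper⁻ : ∀ {G} → proper N G ≡ true → IsFlat N G × G ≢ hat0 N × G ≢ ground N
  proper⁻ G-proper =
    let G-flat , rest = ∧-true⁻ G-proper
        G≢0̂ , G≢E = ∧-true⁻ rest
    in G-flat , ≟ˢ-≢⁻ (not-injective G≢0̂) , ≟ˢ-≢⁻ (not-injective G≢E)

  proper⁺ : ∀ {G} → IsFlat N G → G ≢ hat0 N → G ≢ ground N → proper N G ≡ true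
  proper⁺ G-flat G≢0̂ G≢E rewrite G-flat | ≟ˢ-≢ G≢0̂ | ≟ˢ-≢ G≢E = refl

  private
    meet : Subset n → Subset n → Subset n
    meet S acc = if flat N S then S ∩ acc else acc

  hat0-⊆ : ∀ {S} → IsFlat N S → hat0 N ⊆ S
  hat0-⊆ {S} S-flat = go (allSubsets n) (∈-allSubsets S)
    where
    meet-⊆ : ∀ T acc → meet T acc ⊆ acc
    meet-⊆ T acc with flat N T
    ... | true  = p∩q⊆q T acc
    ... | false = ⊆-refl

    go : ∀ xs → S ∈ˡ xs → foldr meet (ground N) xs ⊆ S
    go (_ ∷ xs) (here refl) rewrite S-flat = p∩q⊆p S _
    go (T ∷ xs) (there S∈xs) = ⊆-trans (meet-⊆ T _) (go xs S∈xs)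

  hat0-flat : IsMatroid N → IsFlat N (hat0 N)
  hat0-flat N-matroid = foldr-preservesʳ meet-flat F1 (allSubsets n)
    where
    open IsMatroid N-matroid
    meet-flat : ∀ S {acc} → IsFlat N acc → IsFlat N (meet S acc)
    meet-flat S acc-flat with flat N S in S-flat
    ... | true  = F2 S _ S-flat acc-flat
    ... | false = acc-flat

  minor-flat⁺ : ∀ {A B H} → IsFlat N H → A ⊆ H → H ⊆ B → IsFlat (minor N A B) (H ─ A)
  minor-flat⁺ {A} {B} {H} H-flat A⊆H H⊆B =
    Equivalence.to T-≡ (any⁺ _ (lose (∈-allSubsets H) (Equivalence.from T-≡ H-witness)))
    where
    H-witness : flat N H ∧ (A ⊆ᵇ H) ∧ (H ⊆ᵇ B) ∧ ((H ─ A) ≟ˢ (H ─ A)) ≡ true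
    H-witness rewrite H-flat | ⊆ᵇ-true A⊆H | ⊆ᵇ-true H⊆B | ≟ˢ-≡ {G = H ─ A} refl = refl

  minor-flat⁻ : ∀ {A B S} → IsFlat (minor N A B) S →
                Σ (Subset n) λ H → IsFlat N H × A ⊆ H × H ⊆ B × S ≡ H ─ A
  minor-flat⁻ S-flat with H , H-witness ← satisfied (any⁻ _ (allSubsets n) (Equivalence.from T-≡ S-flat)) =
    let H-flat , rest = ∧-true⁻ (Equivalence.to T-≡ H-witness)
        A⊆H , rest′ = ∧-true⁻ rest
        H⊆B , S≡H─A = ∧-true⁻ rest′
    in H , H-flat , ⊆ᵇ-true⁻ A⊆H , ⊆ᵇ-true⁻ H⊆B , ≟ˢ-≡⁻ S≡H─A

minor-hat0≡⊥ : ∀ {n} (N : FlatSystem n) {A B} → IsFlat N A → A ⊆ B → hat0 (minor N A B) ≡ ⊥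
minor-hat0≡⊥ N {A} {B} A-flat A⊆B = ⊆-antisym (hat0-⊆ (minor N A B) ⊥-flat) ⊥⊆
  where
  ⊥-flat : IsFlat (minor N A B) ⊥
  ⊥-flat = subst (IsFlat (minor N A B)) (p─p≡⊥ A) (minor-flat⁺ N A-flat ⊆-refl A⊆B)

module _ {n : ℕ} (N : FlatSystem n) where

  spanTerm : (Fin n → Fin n → ℚ) → Fin n → Fin n → Vector n
  spanTerm μ i j G = if (i ∈ᵇ ground N) ∧ (j ∈ᵇ ground N) then μ i j * (αv i G - αv j G) else 0ℚ

  spanSum : (Fin n → Fin n → ℚ) → Vector n
  spanSum μ G = sumℚ (allFin n) λ i → sumℚ (allFin n) λ j → spanTerm μ i j G

  -- x ≈L y unfolds to InW N (λ G → x G - y G).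
  InW : Vector n → Set
  InW v = Σ (Fin n → Fin n → ℚ) λ μ → ∀ G → proper N G ≡ true → v G ≡ spanSum μ G

  spanTerm-zero : ∀ μ i j G → μ i j ≡ 0ℚ → spanTerm μ i j G ≡ 0ℚ
  spanTerm-zero μ i j G μij≡0 with (i ∈ᵇ ground N) ∧ (j ∈ᵇ ground N)
  ... | true  = trans (cong (_* (αv i G - αv j G)) μij≡0) (*-zeroˡ (αv i G - αv j G))
  ... | false = refl

  spanSum-+ : ∀ μ ν G → spanSum (λ i j → μ i j + ν i j) G ≡ spanSum μ G + spanSum ν G
  spanSum-+ μ ν G = trans
    (sum-cong (allFin n) λ i → trans (sum-cong (allFin n) (term i)) (sum-+ (allFin n) (μ-term i) (ν-term i)))
    (sum-+ (allFin n) (λ i → sumℚ (allFin n) (μ-term i)) (λ i → sumℚ (allFin n) (ν-term i)))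
    where
    μ-term ν-term : Fin n → Fin n → ℚ
    μ-term i j = spanTerm μ i j G
    ν-term i j = spanTerm ν i j G

    term : ∀ i j → spanTerm (λ i j → μ i j + ν i j) i j G ≡ μ-term i j + ν-term i j
    term i j with (i ∈ᵇ ground N) ∧ (j ∈ᵇ ground N)
    ... | true  = solve 3 (λ a b d → (a :+ b) :* d := a :* d :+ b :* d) refl (μ i j) (ν i j) (αv i G - αv j G)
    ... | false = refl

  spanSum-* : ∀ q μ G → spanSum (λ i j → q * μ i j) G ≡ q * spanSum μ G
  spanSum-* q μ G = trans
    (sum-cong (allFin n) λ i → trans (sum-cong (allFin n) (term i)) (sum-*ˡ (allFin n) q (μ-term i)))
    (sum-*ˡ (allFin n) q (λ i → sumℚ (allFin n) (μ-term i)))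
    where
    μ-term : Fin n → Fin n → ℚ
    μ-term i j = spanTerm μ i j G

    term : ∀ i j → spanTerm (λ i j → q * μ i j) i j G ≡ q * μ-term i j
    term i j with (i ∈ᵇ ground N) ∧ (j ∈ᵇ ground N)
    ... | true  = solve 3 (λ q a d → (q :* a) :* d := q :* (a :* d)) refl q (μ i j) (αv i G - αv j G)
    ... | false = sym (*-zeroʳ q)

  InW-cong : ∀ {v w} → (∀ G → proper N G ≡ true → v G ≡ w G) → InW v → InW w
  InW-cong v≗w (μ , v≡μ) = μ , λ G p → trans (sym (v≗w G p)) (v≡μ G p)

  InW-0 : InW (λ _ → 0ℚ)
  InW-0 = (λ _ _ → 0ℚ) , λ G _ →
    sym (sum-vanishing (allFin n) λ {i} _ → sum-vanishing (allFin n) λ {j} _ → spanTerm-zero _ i j G refl)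

  InW-+ : ∀ {v w} → InW v → InW w → InW (λ G → v G + w G)
  InW-+ (μ , v≡μ) (ν , w≡ν) = (λ i j → μ i j + ν i j) , λ G p →
    trans (cong₂ _+_ (v≡μ G p) (w≡ν G p)) (sym (spanSum-+ μ ν G))

  InW-* : ∀ q {v} → InW v → InW (λ G → q * v G)
  InW-* q (μ , v≡μ) = (λ i j → q * μ i j) , λ G p →
    trans (cong (q *_) (v≡μ G p)) (sym (spanSum-* q μ G))

  InW-sum : ∀ {A : Set} (xs : List A) {f : A → Vector n} → (∀ a → InW (f a)) →
            InW (λ G → sumℚ xs λ a → f a G)
  InW-sum []       _      = InW-0
  InW-sum (x ∷ xs) f∈W = InW-+ (f∈W x) (InW-sum xs f∈W)

  InW-generator : ∀ {a b} → a ∈ ground N → b ∈ ground N → InW (λ G → αv a G - αv b G)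
  InW-generator {a} {b} a∈E b∈E = μ , λ G _ → sym (μ-spans G)
    where
    μ : Fin n → Fin n → ℚ
    μ i j = if ⌊ i ≟ᶠ a ⌋ ∧ ⌊ j ≟ᶠ b ⌋ then 1ℚ else 0ℚ

    μ-i≢a : ∀ {i j} → i ≢ a → μ i j ≡ 0ℚ
    μ-i≢a i≢a rewrite ⌊⌋-false (_ ≟ᶠ a) i≢a = refl

    μ-j≢b : ∀ {j} → j ≢ b → μ a j ≡ 0ℚ
    μ-j≢b j≢b rewrite ⌊⌋-true (a ≟ᶠ a) refl | ⌊⌋-false (_ ≟ᶠ b) j≢b = refl

    μ-ab : ∀ G → spanTerm μ a b G ≡ αv a G - αv b G
    μ-ab G rewrite ∈ᵇ-∈ a∈E | ∈ᵇ-∈ b∈E | ⌊⌋-true (a ≟ᶠ a) refl | ⌊⌋-true (b ≟ᶠ b) refl =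
      *-identityˡ (αv a G - αv b G)

    μ-spans : ∀ G → spanSum μ G ≡ αv a G - αv b G
    μ-spans G = begin
      spanSum μ G
        ≡⟨ sum-single (allFin⁺ n) (∈-allFin a) (λ {i} _ i≢a →
             sum-vanishing (allFin n) λ {j} _ → spanTerm-zero μ i j G (μ-i≢a i≢a)) ⟩
      sumℚ (allFin n) (λ j → spanTerm μ a j G)
        ≡⟨ sum-single (allFin⁺ n) (∈-allFin b) (λ {j} _ j≢b → spanTerm-zero μ a j G (μ-j≢b j≢b)) ⟩
      spanTerm μ a b G
        ≡⟨ μ-ab G ⟩
      αv a G - αv b G ∎

pullback : ∀ {n} → (Subset n → Subset n) → (Subset n → ℚ) → Subset n → Vector n → Vector n
pullback h r F v K = v (h K) - v F * r K

StrictlySubmodularOn : ∀ {n} → Subset n → (Subset n → ℚ) → Set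
StrictlySubmodularOn E c = ∀ I₁ I₂ → I₁ ⊆ E → I₂ ⊆ E → ¬ (I₁ ⊆ I₂) → ¬ (I₂ ⊆ I₁) →
  c (I₁ ∩ I₂) + c (I₁ ∪ I₂) < c I₁ + c I₂

<-subtract-balanced : ∀ a b c d x y z w k → x + y ≡ z + w → a + b < c + d →
                (a - k * x) + (b - k * y) < (c - k * z) + (d - k * w)
<-subtract-balanced a b c d x y z w k x+y≡z+w a+b<c+d =
  subst₂ _<_ (regroup a b x y) (trans (cong (λ t → c + d + - (k * t)) x+y≡z+w) (regroup c d z w))
    (+-monoˡ-< (- (k * (x + y))) a+b<c+d)
  where
  regroup : ∀ a b x y → a + b + - (k * (x + y)) ≡ (a - k * x) + (b - k * y)
  regroup a b x y = solve 5 (λ a b x y k → a :+ b :+ :- (k :* (x :+ y)) := (a :- k :* x) :+ (b :- k :* y)) refl a b x y k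

module _ {n : ℕ} (h : Subset n → Subset n) (r : Subset n → ℚ) (F : Subset n) where

  pullback-* : ∀ q v K → pullback h r F (λ G → q * v G) K ≡ q * pullback h r F v K
  pullback-* q v K = solve 4 (λ q a b c → q :* a :- q :* b :* c := q :* (a :- b :* c)) refl q (v (h K)) (v F) (r K)

  pullback-─ : ∀ v w K → pullback h r F (λ G → v G - w G) K ≡ pullback h r F v K - pullback h r F w K
  pullback-─ v w K = solve 5 (λ a b c d e → (a :- b) :- (c :- d) :* e := (a :- c :* e) :- (b :- d :* e)) refl
    (v (h K)) (w (h K)) (v F) (w F) (r K)

  pullback-strictlySubmodularOn : ∀ {E E′ c} → Modular r →
    (∀ I J → h (I ∩ J) ≡ h I ∩ h J) → (∀ I J → h (I ∪ J) ≡ h I ∪ h J) →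
    (∀ {I} → I ⊆ E′ → h I ⊆ E) → (∀ {I J} → I ⊆ E′ → h I ⊆ h J → I ⊆ J) →
    StrictlySubmodularOn E c → StrictlySubmodularOn E′ (pullback h r F c)
  pullback-strictlySubmodularOn {c = c} r-modular h-∩ h-∪ h-into h-reflects c-submodular I J I⊆E′ J⊆E′ I⊈J J⊈I =
    subst₂ (λ A B → (c A - c F * r (I ∩ J)) + (c B - c F * r (I ∪ J)) < pullback h r F c I + pullback h r F c J)
      (sym (h-∩ I J)) (sym (h-∪ I J))
      (<-subtract-balanced (c (h I ∩ h J)) (c (h I ∪ h J)) (c (h I)) (c (h J)) (r (I ∩ J)) (r (I ∪ J)) (r I) (r J) (c F)
        (r-modular I J)
        (c-submodular (h I) (h J) (h-into I⊆E′) (h-into J⊆E′)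
           (I⊈J ∘ h-reflects I⊆E′) (J⊈I ∘ h-reflects J⊆E′)))

module _ {n : ℕ} (M N : FlatSystem n) (h : Subset n → Subset n) (r : Subset n → ℚ) (F : Subset n) where

  private
    ϕ : Vector n → Vector n
    ϕ = pullback h r F

  pullback-generator : (g : Fin n → Fin n) (t : Subset n → ℚ) →
    (∀ a → a ∈ ground M → g a ∈ ground N) →
    (∀ a K → proper N K ≡ true → αv a (h K) - αv a F * r K ≡ αv (g a) K - t K) →
    ∀ a b → a ∈ ground M → b ∈ ground M → InW N (ϕ (λ G → αv a G - αv b G))
  pullback-generator g t g-into αv-shift a b a∈E b∈E =
    InW-cong N ϕ-generator (InW-generator N (g-into a a∈E) (g-into b b∈E))
    where
    ϕ-generator : ∀ K → proper N K ≡ true → αv (g a) K - αv (g b) K ≡ ϕ (λ G → αv a G - αv b G) K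
    ϕ-generator K p = begin
      αv (g a) K - αv (g b) K
        ≡⟨ solve 3 (λ u v t → u :- v := (u :- t) :- (v :- t)) refl (αv (g a) K) (αv (g b) K) (t K) ⟩
      (αv (g a) K - t K) - (αv (g b) K - t K)
        ≡⟨ sym (cong₂ _-_ (αv-shift a K p) (αv-shift b K p)) ⟩
      (αv a (h K) - αv a F * r K) - (αv b (h K) - αv b F * r K)
        ≡⟨ sym (pullback-─ h r F (αv a) (αv b) K) ⟩
      ϕ (λ G → αv a G - αv b G) K ∎

  module _ (F-proper : proper M F ≡ true) (h-proper : ∀ K → proper N K ≡ true → proper M (h K) ≡ true) where

    pullback-InW : (∀ a b → a ∈ ground M → b ∈ ground M → InW N (ϕ (λ G → αv a G - αv b G))) →
                   ∀ {v} → InW M v → InW N (ϕ v)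
    pullback-InW generator-InW {v} (μ , v≡μ) =
      InW-cong N (λ K p → sym (ϕv≡ K p)) (InW-sum N (allFin n) λ i → InW-sum N (allFin n) λ j → ϕterm-InW i j)
      where
      term : Fin n → Fin n → Vector n
      term = spanTerm M μ

      ϕv≡ : ∀ K → proper N K ≡ true → ϕ v K ≡ sumℚ (allFin n) λ i → sumℚ (allFin n) λ j → ϕ (term i j) K
      ϕv≡ K p = begin
        v (h K) - v F * r K
          ≡⟨ cong₂ (λ s t → s - t * r K) (v≡μ (h K) (h-proper K p)) (v≡μ F F-proper) ⟩
        spanSum M μ (h K) - spanSum M μ F * r K
          ≡⟨ sum-linear (allFin n) (λ i → sumℚ (allFin n) λ j → term i j (h K))
                                   (λ i → sumℚ (allFin n) λ j → term i j F) (r K) ⟩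
        sumℚ (allFin n) (λ i → sumℚ (allFin n) (λ j → term i j (h K)) - sumℚ (allFin n) (λ j → term i j F) * r K)
          ≡⟨ sum-cong (allFin n) (λ i → sum-linear (allFin n) (λ j → term i j (h K)) (λ j → term i j F) (r K)) ⟩
        sumℚ (allFin n) (λ i → sumℚ (allFin n) λ j → ϕ (term i j) K) ∎

      ϕterm-InW : ∀ i j → InW N (ϕ (term i j))
      ϕterm-InW i j with i ∈? ground M | j ∈? ground M
      ... | yes i∈E | yes j∈E =
        InW-cong N (λ K _ → sym (pullback-* h r F (μ i j) _ K)) (InW-* N (μ i j) (generator-InW i j i∈E j∈E))
      ... | yes _   | no _    = InW-cong N (λ K _ → sym (cong (_-_ 0ℚ) (*-zeroˡ (r K)))) (InW-0 N)
      ... | no _    | _       = InW-cong N (λ K _ → sym (cong (_-_ 0ℚ) (*-zeroˡ (r K)))) (InW-0 N)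

    pullback-ample : (g : Fin n → Fin n) (t : Subset n → ℚ) →
      (∀ a → a ∈ ground M → g a ∈ ground N) →
      (∀ a K → proper N K ≡ true → αv a (h K) - αv a F * r K ≡ αv (g a) K - t K) →
      (∀ c → StrictlySubmodular M c → StrictlySubmodular N (ϕ c)) →
      ∀ x → InAmple M x → InAmple N (ϕ x)
    pullback-ample g t g-into αv-shift ϕ-submodular x (c , c-submodular , x≈c) =
      ϕ c , ϕ-submodular c c-submodular ,
      InW-cong N (λ K _ → pullback-─ h r F x c K) (pullback-InW (pullback-generator g t g-into αv-shift) x≈c)

InAmple-cong : ∀ {n} (N : FlatSystem n) {x y} → (∀ K → proper N K ≡ true → x K ≡ y K) → InAmple N x → InAmple N y
InAmple-cong N x≗y (c , c-submodular , x≈c) = c , c-submodular , InW-cong N (λ K p → cong (_- c K) (x≗y K p)) x≈c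

module _ {n : ℕ} (M : FlatSystem n) (F : Subset n) (F-proper : proper M F ≡ true) where

  πUp≗pullback : ∀ i x {K} → proper M K ≡ true → K ⊆ F → K ≢ F → πUp M F i x K ≡ pullback id (αv i) F x K
  πUp≗pullback i x {K} K-proper K⊆F K≢F = begin
    sumℚ (allSubsets n) term
      ≡⟨ sum-pair (unique-allSubsets n) (∈-allSubsets K) (∈-allSubsets F) K≢F term-elsewhere ⟩
    term K + term F
      ≡⟨ cong₂ _+_ term-K term-F ⟩
    x K * 1ℚ + x F * - αv i K
      ≡⟨ solve 3 (λ a b c → a :* con 1ℚ :+ b :* (:- c) := a :- b :* c) refl (x K) (x F) (αv i K) ⟩
    x K - x F * αv i K ∎
    where
    term : Subset n → ℚ
    term G = if proper M G
      then x G * (if G ⊊ᵇ F then (if G ≟ˢ K then 1ℚ else 0ℚ) else if G ≟ˢ F then - αv i K else 0ℚ)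
      else 0ℚ

    term-K : term K ≡ x K * 1ℚ
    term-K rewrite K-proper | ⊊ᵇ-true K⊆F K≢F | ≟ˢ-≡ {G = K} refl = refl

    term-F : term F ≡ x F * - αv i K
    term-F rewrite F-proper | ⊊ᵇ-irrefl F | ≟ˢ-≡ {G = F} refl = refl

    term-elsewhere : ∀ {G} → G ∈ˡ allSubsets n → G ≢ K → G ≢ F → term G ≡ 0ℚ
    term-elsewhere {G} _ G≢K G≢F rewrite ≟ˢ-≢ G≢K | ≟ˢ-≢ G≢F with proper M G
    ... | false = refl
    ... | true  = trans (cong (x G *_) (if-eta (G ⊆ᵇ F ∧ true))) (*-zeroʳ (x G))

  πDown≗pullback : ∀ i x {K} → proper M (K ∪ F) ≡ true → (K ∪ F) ─ F ≡ K → F ≢ K ∪ F →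
                   πDown M F i x K ≡ pullback (_∪ F) (βv i) F x K
  πDown≗pullback i x {K} K∪F-proper K∪F─F≡K F≢K∪F = begin
    sumℚ (allSubsets n) term
      ≡⟨ sum-pair (unique-allSubsets n) (∈-allSubsets (K ∪ F)) (∈-allSubsets F) (≢-sym F≢K∪F) term-elsewhere ⟩
    term (K ∪ F) + term F
      ≡⟨ cong₂ _+_ term-K∪F term-F ⟩
    x (K ∪ F) * 1ℚ + x F * - βv i K
      ≡⟨ solve 3 (λ a b c → a :* con 1ℚ :+ b :* (:- c) := a :- b :* c) refl (x (K ∪ F)) (x F) (βv i K) ⟩
    x (K ∪ F) - x F * βv i K ∎
    where
    term : Subset n → ℚ
    term G = if proper M G
      then x G * (if F ⊊ᵇ G then (if (G ─ F) ≟ˢ K then 1ℚ else 0ℚ) else if G ≟ˢ F then - βv i K else 0ℚ)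
      else 0ℚ

    term-K∪F : term (K ∪ F) ≡ x (K ∪ F) * 1ℚ
    term-K∪F rewrite K∪F-proper | ⊊ᵇ-true (q⊆p∪q K F) F≢K∪F | ≟ˢ-≡ K∪F─F≡K = refl

    term-F : term F ≡ x F * - βv i K
    term-F rewrite F-proper | ⊊ᵇ-irrefl F | ≟ˢ-≡ {G = F} refl = refl

    ─F≡K⇒≡K∪F : ∀ {G} → F ⊆ G → G ─ F ≡ K → G ≡ K ∪ F
    ─F≡K⇒≡K∪F F⊆G G─F≡K = trans (sym (p─q∪q≡p F⊆G)) (cong (_∪ F) G─F≡K)

    term-elsewhere : ∀ {G} → G ∈ˡ allSubsets n → G ≢ K ∪ F → G ≢ F → term G ≡ 0ℚ
    term-elsewhere {G} _ G≢K∪F G≢F rewrite ≟ˢ-≢ G≢F with proper M G | F ⊊ᵇ G in F⊊G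
    ... | false | _     = refl
    ... | true  | false = *-zeroʳ (x G)
    ... | true  | true  rewrite ≟ˢ-≢ (G≢K∪F ∘ ─F≡K⇒≡K∪F (⊊ᵇ-true⇒⊆ F⊊G)) = *-zeroʳ (x G)

  module _ (M-matroid : IsMatroid M) where
    open IsMatroid M-matroid

    private
      F-flat : IsFlat M F
      F-flat = proj₁ (proper⁻ M F-proper)

      F⊆E : F ⊆ ground M
      F⊆E = flats⊆E F F-flat

    module _ (loopless : Loopless M) where

      ground-upper : ground (upper M F) ≡ F
      ground-upper = trans (cong (F ─_) loopless) (p─⊥≡p F)

      proper-upper⁻ : ∀ {K} → proper (upper M F) K ≡ true → proper M K ≡ true × K ⊆ F × K ≢ F
      proper-upper⁻ {K} K-proper =
        let K-flatᵁ , K≢0̂ᵁ , K≢Eᵁ = proper⁻ (upper M F) K-proper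
            H , H-flat , _ , H⊆F , K≡H─0̂ = minor-flat⁻ M K-flatᵁ
            K≡H = trans K≡H─0̂ (trans (cong (H ─_) loopless) (p─⊥≡p H))
            K⊆F = subst (_⊆ F) (sym K≡H) H⊆F
            0̂ᵁ≡0̂ = trans (minor-hat0≡⊥ M (hat0-flat M M-matroid) (hat0-⊆ M F-flat)) (sym loopless)
        in proper⁺ M (subst (IsFlat M) (sym K≡H) H-flat)
                     (λ K≡0̂ → K≢0̂ᵁ (trans K≡0̂ (sym 0̂ᵁ≡0̂)))
                     (λ K≡E → F≢E (⊆-antisym F⊆E (subst (_⊆ F) K≡E K⊆F)))
           , K⊆F
           , λ K≡F → K≢Eᵁ (trans K≡F (sym ground-upper))
        where
        F≢E : F ≢ ground M
        F≢E = proj₂ (proj₂ (proper⁻ M F-proper))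

      upper-ample : ∀ i → i ∈ F → ∀ x → InAmple M x → InAmple (upper M F) (πUp M F i x)
      upper-ample i i∈F x x-ample =
        InAmple-cong U (λ K p → let K-proper , K⊆F , K≢F = proper-upper⁻ p
                                in sym (πUp≗pullback i x K-proper K⊆F K≢F))
          (pullback-ample M U id (αv i) F F-proper (λ _ → proj₁ ∘ proper-upper⁻)
             g (αv i) g-into αv-shift submodular x x-ample)
        where
        U : FlatSystem n
        U = upper M F

        g : Fin n → Fin n
        g a = if a ∈ᵇ F then a else i

        g-into : ∀ a → a ∈ ground M → g a ∈ ground U
        g-into a _ with a ∈? F
        ... | yes a∈F = subst (a ∈_) (sym ground-upper) a∈F
        ... | no _    = subst (i ∈_) (sym ground-upper) i∈F

        αv-shift : ∀ a K → proper U K ≡ true → αv a K - αv a F * αv i K ≡ αv (g a) K - αv i K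
        αv-shift a K K-proper with a ∈? F
        ... | yes _   = cong (_-_ (αv a K)) (*-identityˡ (αv i K))
        ... | no a∉F rewrite αv-∉ (a∉F ∘ proj₁ (proj₂ (proper-upper⁻ K-proper))) =
          solve 1 (λ u → con 0ℚ :- con 0ℚ :* u := u :- u) refl (αv i K)

        submodular : ∀ c → StrictlySubmodular M c → StrictlySubmodular U (pullback id (αv i) F c)
        submodular c (c⊥≡0 , cE≡0 , c-submodular) =
          c′⊥≡0 , c′Eᵁ≡0 ,
          pullback-strictlySubmodularOn id (αv i) F {c = c} (αv-modular i) (λ _ _ → refl) (λ _ _ → refl)
            (λ I⊆Eᵁ → ⊆-trans (subst (_ ⊆_) ground-upper I⊆Eᵁ) F⊆E) (λ _ → id) c-submodular
          where
          c′⊥≡0 : c ⊥ - c F * αv i ⊥ ≡ 0ℚ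
          c′⊥≡0 rewrite c⊥≡0 | αv-∉ {i = i} {⊥} ∉⊥ =
            solve 1 (λ a → con 0ℚ :- a :* con 0ℚ := con 0ℚ) refl (c F)

          c′Eᵁ≡0 : c (ground U) - c F * αv i (ground U) ≡ 0ℚ
          c′Eᵁ≡0 rewrite ground-upper | αv-∈ i∈F = solve 1 (λ a → a :- a :* con 1ℚ := con 0ℚ) refl (c F)

    proper-lower⁻ : ∀ {K} → proper (lower M F) K ≡ true →
                    proper M (K ∪ F) ≡ true × (K ∪ F) ─ F ≡ K × F ≢ K ∪ F
    proper-lower⁻ {K} K-proper =
      let K-flatᴸ , K≢0̂ᴸ , K≢Eᴸ = proper⁻ (lower M F) K-proper
          H , H-flat , F⊆H , _ , K≡H─F = minor-flat⁻ M K-flatᴸ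
          K∪F≡H = trans (cong (_∪ F) K≡H─F) (p─q∪q≡p F⊆H)
          K∪F─F≡K = trans (cong (_─ F) K∪F≡H) (sym K≡H─F)
          H≢0̂ = λ H≡0̂ → F≢0̂ (⊆-antisym (subst (F ⊆_) H≡0̂ F⊆H) (hat0-⊆ M F-flat))
          H≢E = λ H≡E → K≢Eᴸ (trans K≡H─F (cong (_─ F) H≡E))
      in subst (λ G → proper M G ≡ true) (sym K∪F≡H) (proper⁺ M H-flat H≢0̂ H≢E)
       , K∪F─F≡K
       , λ F≡K∪F → K≢0̂ᴸ (begin
           K                      ≡⟨ sym K∪F─F≡K ⟩
           (K ∪ F) ─ F            ≡⟨ cong (_─ F) (sym F≡K∪F) ⟩
           F ─ F                  ≡⟨ p─p≡⊥ F ⟩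
           ⊥                      ≡⟨ sym (minor-hat0≡⊥ M F-flat F⊆E) ⟩
           hat0 (lower M F)       ∎)
      where
      F≢0̂ : F ≢ hat0 M
      F≢0̂ = proj₁ (proj₂ (proper⁻ M F-proper))

    lower-ample : ∀ i → i ∈ ground M → i ∉ F → ∀ x → InAmple M x → InAmple (lower M F) (πDown M F i x)
    lower-ample i i∈E i∉F x x-ample =
      InAmple-cong L (λ K p → let K∪F-proper , K∪F─F≡K , F≢K∪F = proper-lower⁻ p
                              in sym (πDown≗pullback i x K∪F-proper K∪F─F≡K F≢K∪F))
        (pullback-ample M L (_∪ F) (βv i) F F-proper (λ _ → proj₁ ∘ proper-lower⁻)
           g (λ _ → 0ℚ) g-into αv-shift submodular x x-ample)
      where
      L : FlatSystem n
      L = lower M F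

      g : Fin n → Fin n
      g a = if a ∈ᵇ F then i else a

      g-into : ∀ a → a ∈ ground M → g a ∈ ground L
      g-into a a∈E with a ∈? F
      ... | yes _   = x∈p∧x∉q⇒x∈p─q i∈E i∉F
      ... | no a∉F = x∈p∧x∉q⇒x∈p─q a∈E a∉F

      αv-shift : ∀ a K → proper L K ≡ true → αv a (K ∪ F) - αv a F * βv i K ≡ αv (g a) K - 0ℚ
      αv-shift a K _ with a ∈? F
      ... | yes a∈F rewrite αv-∈ (q⊆p∪q K F a∈F) | βv≡1-αv {i = i} {K} =
        solve 1 (λ u → con 1ℚ :- con 1ℚ :* (con 1ℚ :- u) := u :- con 0ℚ) refl (αv i K)
      ... | no a∉F rewrite αv-∪-∉ K a∉F = cong (_-_ (αv a K)) (*-zeroˡ (βv i K))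

      into : ∀ {I} → I ⊆ ground L → I ∪ F ⊆ ground M
      into {I} I⊆Eᴸ = [ p─q⊆p (ground M) F ∘ I⊆Eᴸ , F⊆E ] ∘ x∈p∪q⁻ I F

      reflects : ∀ {I J} → I ⊆ ground L → I ∪ F ⊆ J ∪ F → I ⊆ J
      reflects {I} {J} I⊆Eᴸ I∪F⊆J∪F x∈I =
        [ id , ⊥-elim ∘ x∈p─q⇒x∉q (ground M) F (I⊆Eᴸ x∈I) ] (x∈p∪q⁻ J F (I∪F⊆J∪F (p⊆p∪q F x∈I)))

      submodular : ∀ c → StrictlySubmodular M c → StrictlySubmodular L (pullback (_∪ F) (βv i) F c)
      submodular c (c⊥≡0 , cE≡0 , c-submodular) =
        c′⊥≡0 , c′Eᴸ≡0 ,
        pullback-strictlySubmodularOn (_∪ F) (βv i) F {c = c} (βv-modular i)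
          (λ I J → ∪-distribʳ-∩ F I J) (∪-distribʳ-∪ F) into reflects c-submodular
        where
        c′⊥≡0 : c (⊥ ∪ F) - c F * βv i ⊥ ≡ 0ℚ
        c′⊥≡0 rewrite ∪-identityˡ F | βv-∉ {i = i} {⊥} ∉⊥ =
          solve 1 (λ a → a :- a :* con 1ℚ := con 0ℚ) refl (c F)

        c′Eᴸ≡0 : c ((ground M ─ F) ∪ F) - c F * βv i (ground M ─ F) ≡ 0ℚ
        c′Eᴸ≡0 rewrite p─q∪q≡p F⊆E | cE≡0 | βv-∈ (x∈p∧x∉q⇒x∈p─q i∈E i∉F) =
          solve 1 (λ a → con 0ℚ :- a :* con 0ℚ := con 0ℚ) refl (c F)

mainTheorem9 : ∀ {n} (M : FlatSystem n) → IsMatroid M → Loopless M →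
    ∀ (F : Subset n) → proper M F ≡ true →
      (∀ i → i ∈ F → ∀ x → InAmple M x → InAmple (upper M F) (πUp M F i x))
      × (∀ i → i ∈ ground M → i ∉ F → ∀ x → InAmple M x → InAmple (lower M F) (πDown M F i x))
mainTheorem9 M M-matroid loopless F F-proper =
  upper-ample M F F-proper M-matroid loopless , lower-ample M F F-proper M-matroid
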